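{- Let $G$ be a finite simple connected graph and $\sigma$ a confined position of the parallel chip-firing game on $G$, with complement $\sigma_c$ defined by $\sigma_c(v)=2\deg(v)-1-\sigma(v)$. Then $p(\sigma)=p(\sigma_c)$.
   Context: Parallel chip-firing game on $G$: a position $\sigma$ assigns a nonnegative integer $\sigma(v)$ to each vertex. $\Phi_\sigma(v)$ is the number of neighbors $w$ of $v$ with $\sigma(w)\ge\deg(w)$. Step operator $U$: $U\sigma(v)=\sigma(v)+\Phi_\sigma(v)$ if $\sigma(v)\le\deg(v)-1$, and $U\sigma(v)=\sigma(v)+\Phi_\sigma(v)-\deg(v)$ otherwise. A position is confined if every vertex satisfies $\Phi_\sigma(v)\le\sigma(v)\le\Phi_\sigma(v)+\deg(v)-1$. The period $p(\sigma)$ is the least positive integer $p$ with $U^t\sigma=U^{t+p}\sigma$ for all sufficiently large $t$. -}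

module Defs where

open import Data.Nat using (ℕ; zero; suc; _+_; _*_; _∸_; _≤_; _<_; _≥_; _≤?_; _<?_)
open import Data.Fin using (Fin; zero; suc)
open import Data.Bool using (Bool; true; false; _∧_; if_then_else_)
open import Data.Product using (Σ; ∃; _×_; _,_)
open import Relation.Nullary using (¬_; yes; no)
open import Relation.Nullary.Decidable using (⌊_⌋)
open import Relation.Binary.PropositionalEquality using (_≡_)
open import Function.Bundles using (_⇔_)

record Graph (n : ℕ) : Set where
  field
    adj   : Fin n → Fin n → Bool
    sym   : ∀ u v → adj u v ≡ adj v u
    irrefl : ∀ v → adj v v ≡ false

open Graph public

count : ∀ {n} → (Fin n → Bool) → ℕ
count {zero} p = 0
count {suc n} p = (if p zero then 1 else 0) + count (λ i → p (suc i))

data Reach {n} (G : Graph n) : Fin n → Fin n → Set where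
  here  : ∀ {v} → Reach G v v
  step  : ∀ {u w v} → adj G u w ≡ true → Reach G w v → Reach G u v

Connected : ∀ {n} → Graph n → Set
Connected {n} G = ∀ (u v : Fin n) → Reach G u v

deg : ∀ {n} → Graph n → Fin n → ℕ
deg G v = count (adj G v)

Position : ℕ → Set
Position n = Fin n → ℕ

Φ : ∀ {n} → Graph n → Position n → Fin n → ℕ
Φ G σ v = count (λ w → adj G v w ∧ ⌊ deg G w ≤? σ w ⌋)

U : ∀ {n} → Graph n → Position n → Position n
U G σ v with σ v <? deg G v
... | yes _ = σ v + Φ G σ v
... | no  _ = (σ v + Φ G σ v) ∸ deg G v

iter : ∀ {n} → Graph n → ℕ → Position n → Position n
iter G zero σ = σ
iter G (suc t) σ = U G (iter G t σ)

-- confined: Φ_σ(v) ≤ σ(v) ≤ Φ_σ(v) + deg(v) - 1 (upper bound stated over ℤ, i.e. σ(v) < Φ_σ(v)+deg(v))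
Confined : ∀ {n} → Graph n → Position n → Set
Confined G σ = ∀ v → Φ G σ v ≤ σ v × σ v < Φ G σ v + deg G v

complement : ∀ {n} → Graph n → Position n → Position n
complement G σ v = (2 * deg G v ∸ 1) ∸ σ v

EventuallyPeriodic : ∀ {n} → Graph n → Position n → ℕ → Set
EventuallyPeriodic G σ p =
  ∃ λ t₀ → ∀ t → t₀ ≤ t → ∀ v → iter G t σ v ≡ iter G (t + p) σ v

IsPeriod : ∀ {n} → Graph n → Position n → ℕ → Set
IsPeriod G σ p = 0 < p × EventuallyPeriodic G σ p
  × (∀ q → 0 < q → EventuallyPeriodic G σ q → p ≤ q)

module Submission where

-- Complementation commutes with the parallel chip-firing step.
--
-- Write mirror N x = (N - 1) - x, so that σ_c(v) = mirror (2 deg v) (σ v).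
-- The only property of a confined position used is the bound σ(v) < 2 deg(v);
-- call such positions bounded.  For bounded σ:
--   * a vertex is active in σ_c iff it is inactive in σ, so
--     Φ_{σ_c}(v) + Φ_σ(v) = deg(v) and both positions share one Φ-budget;
--   * the single-vertex firing rule  fire d x f  (x + f, minus d if x ≥ d)
--     satisfies  fire d (mirror x) f' = mirror (fire d x f)  whenever
--     f + f' = d  (a statement about natural numbers only);
--   * hence U(σ_c) = (Uσ)_c, and U preserves boundedness, so
--     U^t(σ_c) = (U^t σ)_c for every t.
-- Since mirror is injective below 2 deg(v), σ and σ_c are eventually periodic
-- with exactly the same periods q, and so their least periods coincide.

open import Defs hiding (sym)
open import Data.Nat using (ℕ; zero; suc; _+_; _*_; _∸_; _≤_; _<_; _<?_; _≤?_; s≤s)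
open import Data.Nat.Properties
open import Data.Nat.Tactic.RingSolver using (solve-∀)
open import Data.Fin using (Fin; zero; suc)
open import Data.Bool using (Bool; true; false; _∧_; not)
open import Data.Sum using (inj₁; inj₂)
open import Data.Product using (_,_; proj₂)
open import Data.Empty using (⊥-elim)
open import Relation.Nullary using (yes; no)
open import Relation.Nullary.Decidable using (⌊_⌋)
open import Relation.Binary.PropositionalEquality
open import Function.Bundles using (_⇔_; mk⇔; Equivalence)

count-cong : ∀ {n} (p q : Fin n → Bool) → (∀ i → p i ≡ q i) → count p ≡ count q
count-cong {zero}  p q h = refl
count-cong {suc n} p q h rewrite h zero =
  cong (_ +_) (count-cong (λ i → p (suc i)) (λ i → q (suc i)) (λ i → h (suc i)))

count-split : ∀ {n} (a b : Fin n → Bool) →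
  count (λ i → a i ∧ b i) + count (λ i → a i ∧ not (b i)) ≡ count a
count-split {zero}  a b = refl
count-split {suc n} a b with a zero | b zero
... | true  | true  = cong suc (count-split (λ i → a (suc i)) (λ i → b (suc i)))
... | true  | false = trans (+-suc _ _) (cong suc (count-split (λ i → a (suc i)) (λ i → b (suc i))))
... | false | _     = count-split (λ i → a (suc i)) (λ i → b (suc i))

count-∧-≤ : ∀ {n} (a b : Fin n → Bool) → count (λ i → a i ∧ b i) ≤ count a
count-∧-≤ a b = m+n≤o⇒m≤o _ (≤-reflexive (count-split a b))

-- The mirror map x ↦ (N - 1) - x on {0, …, N - 1}.  The relation
-- z + suc y ≡ N says that z and y are mirror images of each other.

mirror : ℕ → ℕ → ℕ
mirror N x = (N ∸ 1) ∸ x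

mirror-spec : ∀ N x → x < N → mirror N x + suc x ≡ N
mirror-spec (suc m) x (s≤s x≤m) = trans (+-suc _ _) (cong suc (m∸n+n≡m x≤m))

mirror-unique : ∀ N y z → z + suc y ≡ N → mirror N y ≡ z
mirror-unique N y z eq rewrite sym eq | +-suc z y = m+n∸n≡m z y

mirror-sym : ∀ a b → a + suc b ≡ b + suc a
mirror-sym a b = trans (+-suc a b) (trans (cong suc (+-comm a b)) (sym (+-suc b a)))

mirror-involutive : ∀ N x → x < N → mirror N (mirror N x) ≡ x
mirror-involutive N x x<N = mirror-unique N _ x (trans (mirror-sym x _) (mirror-spec N x x<N))

mirror-injective : ∀ N a b → a < N → b < N → mirror N a ≡ mirror N b → a ≡ b
mirror-injective N a b a<N b<N eq = begin
  a                     ≡⟨ sym (mirror-involutive N a a<N) ⟩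
  mirror N (mirror N a) ≡⟨ cong (mirror N) eq ⟩
  mirror N (mirror N b) ≡⟨ mirror-involutive N b b<N ⟩
  b                     ∎
  where open ≡-Reasoning

below⇒mirror-above : ∀ d c x → c + suc x ≡ d + d → x < d → d ≤ c
below⇒mirror-above d c x eq x<d = +-cancelʳ-≤ d d c (begin
  d + d      ≡⟨ sym eq ⟩
  c + suc x  ≤⟨ +-monoʳ-≤ c x<d ⟩
  c + d      ∎)
  where open ≤-Reasoning

mirror-above⇒below : ∀ d c x → c + suc x ≡ d + d → d ≤ c → x < d
mirror-above⇒below d c x eq d≤c = +-cancelˡ-≤ d (suc x) d (begin
  d + suc x  ≤⟨ +-monoˡ-≤ (suc x) d≤c ⟩
  c + suc x  ≡⟨ eq ⟩
  d + d      ∎)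
  where open ≤-Reasoning

2*-as-sum : ∀ d → 2 * d ≡ d + d
2*-as-sum d = cong (d +_) (+-identityʳ d)

mirrors : ∀ d x → x < 2 * d → mirror (2 * d) x + suc x ≡ d + d
mirrors d x x<2d = trans (mirror-spec (2 * d) x x<2d) (2*-as-sum d)

active-mirror : ∀ d x → x < 2 * d → ⌊ d ≤? mirror (2 * d) x ⌋ ≡ not ⌊ d ≤? x ⌋
active-mirror d x x<2d with d ≤? mirror (2 * d) x | d ≤? x
... | yes d≤c | yes d≤x = ⊥-elim (<⇒≱ (mirror-above⇒below d _ x (mirrors d x x<2d) d≤c) d≤x)
... | yes _   | no _    = refl
... | no _    | yes _   = refl
... | no d≰c  | no d≰x  = ⊥-elim (d≰c (below⇒mirror-above d _ x (mirrors d x x<2d) (≰⇒> d≰x)))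

fire : ℕ → ℕ → ℕ → ℕ
fire d x f with x <? d
... | yes _ = x + f
... | no  _ = x + f ∸ d

fire-below : ∀ d x f → x < d → fire d x f ≡ x + f
fire-below d x f x<d with x <? d
... | yes _   = refl
... | no  x≮d = ⊥-elim (x≮d x<d)

fire-above : ∀ d x f → d ≤ x → fire d x f ≡ x + f ∸ d
fire-above d x f d≤x with x <? d
... | yes x<d = ⊥-elim (<⇒≱ x<d d≤x)
... | no  _   = refl

fire-bounded : ∀ d x f → x < 2 * d → f ≤ d → fire d x f < 2 * d
fire-bounded d x f x<2d f≤d with x <? d
... | yes x<d = subst (x + f <_) (sym (2*-as-sum d)) (+-mono-<-≤ x<d f≤d)
... | no  _   = ≤-<-trans (≤-trans (∸-monoˡ-≤ d (+-monoʳ-≤ x f≤d))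
                                   (≤-reflexive (m+n∸n≡m x d))) x<2d

fire-mirror-pair : ∀ d c x f f' → c + suc x ≡ d + d → x < d → f + f' ≡ d →
  (c + f' ∸ d) + suc (x + f) ≡ d + d
fire-mirror-pair d c x f f' c-mirrors-x x<d f+f'
  with m≤n⇒∃[o]m+o≡n (below⇒mirror-above d c x c-mirrors-x x<d)
... | k , refl = begin
  (d + k + f' ∸ d) + suc (x + f)   ≡⟨ cong (λ m → (m ∸ d) + suc (x + f)) (+-assoc d k f') ⟩
  (d + (k + f') ∸ d) + suc (x + f) ≡⟨ cong (_+ suc (x + f)) (m+n∸m≡n d (k + f')) ⟩
  (k + f') + suc (x + f)           ≡⟨ regroup k f' x f ⟩
  (k + suc x) + (f + f')           ≡⟨ cong₂ _+_ k+1+x≡d f+f' ⟩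
  d + d                            ∎
  where
  open ≡-Reasoning
  regroup : ∀ k f' x f → (k + f') + suc (x + f) ≡ (k + suc x) + (f + f')
  regroup = solve-∀
  k+1+x≡d : k + suc x ≡ d
  k+1+x≡d = +-cancelˡ-≡ d _ _ (trans (sym (+-assoc d k (suc x))) c-mirrors-x)

fire-mirror : ∀ d x f f' → x < 2 * d → f + f' ≡ d →
  fire d (mirror (2 * d) x) f' ≡ mirror (2 * d) (fire d x f)
fire-mirror d x f f' x<2d f+f' with <-≤-connex x d
... | inj₁ x<d = begin
  fire d c f'                 ≡⟨ fire-above d c f' (below⇒mirror-above d c x (mirrors d x x<2d) x<d) ⟩
  c + f' ∸ d                  ≡⟨ sym (mirror-unique (2 * d) (x + f) _ pair) ⟩
  mirror (2 * d) (x + f)      ≡⟨ cong (mirror (2 * d)) (sym (fire-below d x f x<d)) ⟩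
  mirror (2 * d) (fire d x f) ∎
  where
  open ≡-Reasoning
  c : ℕ
  c = mirror (2 * d) x
  pair : (c + f' ∸ d) + suc (x + f) ≡ 2 * d
  pair = trans (fire-mirror-pair d c x f f' (mirrors d x x<2d) x<d f+f') (sym (2*-as-sum d))
... | inj₂ d≤x = begin
  fire d c f'                 ≡⟨ fire-below d c f' c<d ⟩
  c + f'                      ≡⟨ sym (mirror-unique (2 * d) (x + f ∸ d) _ pair) ⟩
  mirror (2 * d) (x + f ∸ d)  ≡⟨ cong (mirror (2 * d)) (sym (fire-above d x f d≤x)) ⟩
  mirror (2 * d) (fire d x f) ∎
  where
  -- the roles of x and its mirror image c are exchanged
  open ≡-Reasoning
  c : ℕ
  c = mirror (2 * d) x
  x-mirrors-c : x + suc c ≡ d + d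
  x-mirrors-c = trans (mirror-sym x c) (mirrors d x x<2d)
  c<d : c < d
  c<d = mirror-above⇒below d x c x-mirrors-c d≤x
  pair : (c + f') + suc (x + f ∸ d) ≡ 2 * d
  pair = trans (mirror-sym (c + f') (x + f ∸ d))
    (trans (fire-mirror-pair d x c f' f x-mirrors-c c<d (trans (+-comm f' f) f+f'))
           (sym (2*-as-sum d)))

U-fire : ∀ {n} (G : Graph n) σ v → U G σ v ≡ fire (deg G v) (σ v) (Φ G σ v)
U-fire G σ v with σ v <? deg G v
... | yes _ = refl
... | no  _ = refl

Φ-cong : ∀ {n} (G : Graph n) σ τ → (∀ w → σ w ≡ τ w) → ∀ v → Φ G σ v ≡ Φ G τ v
Φ-cong G σ τ σ≗τ v = count-cong _ _ (λ w → cong (λ z → adj G v w ∧ ⌊ deg G w ≤? z ⌋) (σ≗τ w))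

U-cong : ∀ {n} (G : Graph n) σ τ → (∀ w → σ w ≡ τ w) → ∀ v → U G σ v ≡ U G τ v
U-cong G σ τ σ≗τ v = begin
  U G σ v                                ≡⟨ U-fire G σ v ⟩
  fire (deg G v) (σ v) (Φ G σ v)         ≡⟨ cong₂ (fire (deg G v)) (σ≗τ v) (Φ-cong G σ τ σ≗τ v) ⟩
  fire (deg G v) (τ v) (Φ G τ v)         ≡⟨ sym (U-fire G τ v) ⟩
  U G τ v                                ∎
  where open ≡-Reasoning

Φ≤deg : ∀ {n} (G : Graph n) σ v → Φ G σ v ≤ deg G v
Φ≤deg G σ v = count-∧-≤ (adj G v) _

-- Bounded positions: every vertex holds fewer than 2 deg(v) chips.  This is
-- the range on which the complement is an involution.

Bounded : ∀ {n} → Graph n → Position n → Set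
Bounded G σ = ∀ v → σ v < 2 * deg G v

confined⇒bounded : ∀ {n} (G : Graph n) σ → Confined G σ → Bounded G σ
confined⇒bounded G σ conf v = <-≤-trans (proj₂ (conf v))
  (subst (Φ G σ v + deg G v ≤_) (sym (2*-as-sum (deg G v)))
         (+-monoˡ-≤ (deg G v) (Φ≤deg G σ v)))

U-bounded : ∀ {n} (G : Graph n) σ → Bounded G σ → Bounded G (U G σ)
U-bounded G σ bnd v =
  subst (_< 2 * deg G v) (sym (U-fire G σ v)) (fire-bounded _ _ _ (bnd v) (Φ≤deg G σ v))

iter-bounded : ∀ {n} (G : Graph n) σ → Bounded G σ → ∀ t → Bounded G (iter G t σ)
iter-bounded G σ bnd zero    = bnd
iter-bounded G σ bnd (suc t) = U-bounded G _ (iter-bounded G σ bnd t)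

Φ-complement : ∀ {n} (G : Graph n) σ → Bounded G σ →
  ∀ v → Φ G σ v + Φ G (complement G σ) v ≡ deg G v
Φ-complement G σ bnd v =
  trans (cong (Φ G σ v +_) (count-cong _ _ λ w →
           cong (adj G v w ∧_) (active-mirror (deg G w) (σ w) (bnd w))))
        (count-split (adj G v) (λ w → ⌊ deg G w ≤? σ w ⌋))

U-complement : ∀ {n} (G : Graph n) σ → Bounded G σ →
  ∀ v → U G (complement G σ) v ≡ complement G (U G σ) v
U-complement G σ bnd v = begin
  U G (complement G σ) v                                  ≡⟨ U-fire G _ v ⟩
  fire d (mirror (2 * d) (σ v)) (Φ G (complement G σ) v)  ≡⟨ fire-mirror d (σ v) _ _ (bnd v) (Φ-complement G σ bnd v) ⟩
  mirror (2 * d) (fire d (σ v) (Φ G σ v))                 ≡⟨ cong (mirror (2 * d)) (sym (U-fire G σ v)) ⟩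
  complement G (U G σ) v                                  ∎
  where
  open ≡-Reasoning
  d = deg G v

iter-complement : ∀ {n} (G : Graph n) σ → Bounded G σ →
  ∀ t v → iter G t (complement G σ) v ≡ complement G (iter G t σ) v
iter-complement G σ bnd zero    v = refl
iter-complement G σ bnd (suc t) v =
  trans (U-cong G _ _ (iter-complement G σ bnd t) v)
        (U-complement G (iter G t σ) (iter-bounded G σ bnd t) v)

periodic-complement : ∀ {n} (G : Graph n) σ → Bounded G σ →
  ∀ q → EventuallyPeriodic G σ q ⇔ EventuallyPeriodic G (complement G σ) q
periodic-complement G σ bnd q = mk⇔
  (λ { (t₀ , per) → t₀ , λ t t₀≤t v →
        trans (iter-complement G σ bnd t v)
          (trans (cong (mirror (2 * deg G v)) (per t t₀≤t v))
                 (sym (iter-complement G σ bnd (t + q) v))) })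
  (λ { (t₀ , per) → t₀ , λ t t₀≤t v →
        mirror-injective (2 * deg G v) _ _
          (iter-bounded G σ bnd t v) (iter-bounded G σ bnd (t + q) v)
          (trans (sym (iter-complement G σ bnd t v))
            (trans (per t t₀≤t v) (iter-complement G σ bnd (t + q) v))) })

period-transfer : ∀ {n} (G : Graph n) σ τ →
  (∀ q → EventuallyPeriodic G σ q ⇔ EventuallyPeriodic G τ q) →
  ∀ p → IsPeriod G σ p ⇔ IsPeriod G τ p
period-transfer G σ τ same p = mk⇔
  (λ { (p>0 , per , least) → p>0 , to p per , λ q q>0 perτ → least q q>0 (from q perτ) })
  (λ { (p>0 , per , least) → p>0 , from p per , λ q q>0 perσ → least q q>0 (to q perσ) })
  where
  to : ∀ q → EventuallyPeriodic G σ q → EventuallyPeriodic G τ q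
  to q = Equivalence.to (same q)
  from : ∀ q → EventuallyPeriodic G τ q → EventuallyPeriodic G σ q
  from q = Equivalence.from (same q)

corollary2p4 : ∀ {n} (G : Graph n) → Connected G → (σ : Position n) → Confined G σ →
    ∀ (p : ℕ) → IsPeriod G σ p ⇔ IsPeriod G (complement G σ) p
corollary2p4 G _ σ conf =
  period-transfer G σ (complement G σ)
    (periodic-complement G σ (confined⇒bounded G σ conf))
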